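{- Boundedness (deciding, for a given system, whether $\mathrm{Post}^*(x_0)=\{y\mid x_0\xrightarrow{*}y\}$ is finite) is undecidable for branch-effective branch-WSTS $\mathcal{S}=(X,\Sigma,\to,\leq,x_0)$ in which $\leq$ is a well-quasi-ordering.
   Context: A quasi-ordered labelled transition system (OLTS) is a tuple $(X,\Sigma,\to,\leq,x_0)$ with states $X$, finite alphabet $\Sigma$, transitions ${\to}\subseteq X\times\Sigma\times X$, quasi-ordering $\leq$ on $X$ and initial state $x_0$; $\mathrm{Post}(x)=\{y\mid x\xrightarrow{a}y\text{ for some }a\}$. It is finitely branching if each $\mathrm{Post}(x)$ is finite; branch-wqo if the set of states visited along every run from $x_0$ is well-quasi-ordered by $\leq$; branch-monotone if whenever $x\xrightarrow{\sigma}x'$ ($\sigma\in\Sigma^*$) and $x\leq x'$, there is $y$ with $x'\xrightarrow{\sigma}y$ and $x'\leq y$. A branch-WSTS is a finitely branching, branch-monotone, branch-wqo OLTS; it is branch-effective if $\leq$ and each $\xrightarrow{a}$ are decidable and each $\mathrm{Post}(x)$ is computable. -}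

module Defs where

open import Data.Nat using (ℕ; zero; suc; _+_; _<_)
open import Data.Fin using (Fin; toℕ)
open import Data.Vec using (Vec; []; _∷_; lookup)
open import Data.List using (List)
open import Data.List.Membership.Propositional using (_∈_)
open import Data.Product using (Σ; ∃; ∃-syntax; _×_)
open import Data.Sum using (_⊎_)
open import Relation.Binary.PropositionalEquality using (_≡_)
open import Function.Bundles using (_⇔_)

data Code : ℕ → Set where
  zer  : ∀ {n} → Code n
  succ : Code 1
  proj : ∀ {n} → Fin n → Code n
  comp : ∀ {m n} → Code m → Vec (Code n) m → Code n
  prec : ∀ {n} → Code n → Code (suc (suc n)) → Code (suc n)
  mu   : ∀ {n} → Code (suc n) → Code n

data _▷_⇓_ : ∀ {n} → Code n → Vec ℕ n → ℕ → Set
data _▷*_⇓*_ : ∀ {m n} → Vec (Code n) m → Vec ℕ n → Vec ℕ m → Set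

data _▷_⇓_ where
  ev-zer   : ∀ {n} {xs : Vec ℕ n} → zer ▷ xs ⇓ 0
  ev-succ  : ∀ {x} → succ ▷ (x ∷ []) ⇓ suc x
  ev-proj  : ∀ {n} {i : Fin n} {xs : Vec ℕ n} → proj i ▷ xs ⇓ lookup xs i
  ev-comp  : ∀ {m n} {f : Code m} {gs : Vec (Code n) m} {xs : Vec ℕ n} {ys : Vec ℕ m} {y} →
             gs ▷* xs ⇓* ys → f ▷ ys ⇓ y → comp f gs ▷ xs ⇓ y
  ev-prec0 : ∀ {n} {f : Code n} {g : Code (suc (suc n))} {xs : Vec ℕ n} {y} →
             f ▷ xs ⇓ y → prec f g ▷ (0 ∷ xs) ⇓ y
  ev-precS : ∀ {n} {f : Code n} {g : Code (suc (suc n))} {xs : Vec ℕ n} {k r y} →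
             prec f g ▷ (k ∷ xs) ⇓ r → g ▷ (k ∷ r ∷ xs) ⇓ y → prec f g ▷ (suc k ∷ xs) ⇓ y
  ev-mu    : ∀ {n} {f : Code (suc n)} {xs : Vec ℕ n} {k} →
             f ▷ (k ∷ xs) ⇓ 0 → (∀ i → i < k → ∃[ v ] (f ▷ (i ∷ xs) ⇓ suc v)) → mu f ▷ xs ⇓ k

data _▷*_⇓*_ where
  ev-[] : ∀ {n} {xs : Vec ℕ n} → [] ▷* xs ⇓* []
  ev-∷  : ∀ {m n} {g : Code n} {gs : Vec (Code n) m} {xs : Vec ℕ n} {y} {ys : Vec ℕ m} →
          g ▷ xs ⇓ y → gs ▷* xs ⇓* ys → (g ∷ gs) ▷* xs ⇓* (y ∷ ys)

tri : ℕ → ℕ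
tri zero    = zero
tri (suc n) = suc n + tri n

pair : ℕ → ℕ → ℕ
pair a b = tri (a + b) + b

⌜_⌝ : ∀ {n} → Code n → ℕ
⌜_⌝* : ∀ {m n} → Vec (Code n) m → ℕ

⌜ zer {n} ⌝          = pair 0 n
⌜ succ ⌝             = pair 1 0
⌜ proj {n} i ⌝       = pair 2 (pair n (toℕ i))
⌜ comp {m} {n} f gs ⌝ = pair 3 (pair m (pair n (pair ⌜ f ⌝ ⌜ gs ⌝*)))
⌜ prec {n} f g ⌝     = pair 4 (pair n (pair ⌜ f ⌝ ⌜ g ⌝))
⌜ mu {n} f ⌝         = pair 5 (pair n ⌜ f ⌝)

⌜ [] ⌝*     = 0
⌜ g ∷ gs ⌝* = suc (pair ⌜ g ⌝ ⌜ gs ⌝*)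

-- An OLTS (ℕ, Fin k, →, ≤, x0) given by programs:
--   le    x y     ⇓ 1  iff  x ≤ y           (decider for ≤)
--   tr    a x y   ⇓ 1  iff  x -a-> y        (decider for each -a->)
--   plen  x       = |list enumerating Post(x)|
--   pelem x i     = i-th element of that list
record SysCode : Set where
  field
    k     : ℕ
    x0    : ℕ
    le    : Code 2
    tr    : Code 3
    plen  : Code 1
    pelem : Code 2

⌜_⌝S : SysCode → ℕ
⌜ S ⌝S = pair k (pair x0 (pair ⌜ le ⌝ (pair ⌜ tr ⌝ (pair ⌜ plen ⌝ ⌜ pelem ⌝))))
  where open SysCode S

module _ (S : SysCode) where
  open SysCode S

  _≼_ : ℕ → ℕ → Set
  x ≼ y = le ▷ (x ∷ y ∷ []) ⇓ 1

  Step : ℕ → Fin k → ℕ → Set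
  Step x a y = tr ▷ (toℕ a ∷ x ∷ y ∷ []) ⇓ 1

  data StepW : ℕ → List (Fin k) → ℕ → Set where
    ε   : ∀ {x} → StepW x List.[] x
    _◅_ : ∀ {x y z a σ} → Step x a y → StepW y σ z → StepW x (a List.∷ σ) z

  InPost : ℕ → ℕ → Set
  InPost x y = ∃[ a ] Step x a y

  Reach : ℕ → ℕ → Set
  Reach x y = ∃[ σ ] StepW x σ y

  IsQuasiOrder : Set
  IsQuasiOrder = (∀ x → x ≼ x) × (∀ x y z → x ≼ y → y ≼ z → x ≼ z)

  IsWqo : Set
  IsWqo = IsQuasiOrder × ((f : ℕ → ℕ) → ∃[ i ] ∃[ j ] (i < j × f i ≼ f j))

  -- branch-wqo: states visited along every (infinite) run from x0 are wqo
  -- (finite runs visit finitely many states, which are trivially wqo)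
  IsBranchWqo : Set
  IsBranchWqo = (r : ℕ → ℕ) → r 0 ≡ x0 → (∀ n → InPost (r n) (r (suc n))) →
                (f : ℕ → ℕ) → (∀ n → ∃[ m ] f n ≡ r m) →
                ∃[ i ] ∃[ j ] (i < j × f i ≼ f j)

  IsBranchMonotone : Set
  IsBranchMonotone = ∀ x x' σ → StepW x σ x' → x ≼ x' →
                     ∃[ y ] (StepW x' σ y × x' ≼ y)

  -- branch-effectiveness: ≤ and each -a-> decidable (programs total, 0/1-valued),
  -- Post(x) computable as a finite list (this also gives finite branching)
  IsBranchEffective : Set
  IsBranchEffective =
    (∀ x y → (le ▷ (x ∷ y ∷ []) ⇓ 0) ⊎ (le ▷ (x ∷ y ∷ []) ⇓ 1)) ×
    (∀ (a : Fin k) x y → (tr ▷ (toℕ a ∷ x ∷ y ∷ []) ⇓ 0) ⊎ (tr ▷ (toℕ a ∷ x ∷ y ∷ []) ⇓ 1)) ×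
    (∀ x → ∃[ l ] (plen ▷ (x ∷ []) ⇓ l)) ×
    (∀ x i → ∃[ v ] (pelem ▷ (x ∷ i ∷ []) ⇓ v)) ×
    (∀ x y → InPost x y ⇔ (∃[ l ] ∃[ i ] (plen ▷ (x ∷ []) ⇓ l × i < l × pelem ▷ (x ∷ i ∷ []) ⇓ y)))

  IsEffectiveWqoBranchWSTS : Set
  IsEffectiveWqoBranchWSTS =
    IsWqo × IsBranchWqo × IsBranchMonotone × IsBranchEffective

  Bounded : Set
  Bounded = ∃[ L ] ((y : ℕ) → Reach x0 y → y ∈ L)

{-# OPTIONS --safe #-}
module Submission where

-- Diagonalisation against a would-be decider d.  By a Kleene-style fixed point, build a
-- system S that knows its own Gödel number ⌜ S ⌝: a one-letter counter x ↦ x + 1 on ℕ,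
-- ordered by the total relation, that stops at the first x such that d, run on ⌜ S ⌝ for
-- a budget of x, has answered 0 ("unbounded").  Any deterministic, always-enabled system
-- with the total order is trivially a branch-effective branch-WSTS with a wqo.  If d says
-- "bounded", it never answers 0, so the counter never stops and S is unbounded; if d says
-- "unbounded", it answers 0 within some budget T and every reachable state is ≤ T.  The
-- budgeted run of d is a total recursive function, obtained by structural recursion on
-- codes, which makes the transitions of S decidable.

open import Defs
open import Data.Vec using ([]; _∷_)
open import Data.Product using (Σ; _×_)
open import Relation.Nullary using (¬_)

open import Data.Nat using (ℕ; zero; suc; _+_; _*_; _∸_; _≤_; _<_; z≤n; s≤s; pred; _⊔_)
open import Data.Nat.Properties
open import Data.Fin using (Fin; toℕ) renaming (zero to fz; suc to fs)
open import Data.Vec using (Vec; lookup; map)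
open import Data.Vec.Properties using (map-∘; map-id)
open import Data.Product using (∃-syntax; _,_; proj₁; proj₂)
open import Data.Sum using (_⊎_; inj₁; inj₂; [_,_]′)
open import Data.Empty using (⊥-elim)
open import Relation.Binary using (tri<; tri≈; tri>)
open import Relation.Binary.PropositionalEquality
open import Function using (_∘_)
open import Function.Bundles using (mk⇔)
import Data.List as List
import Data.List.Relation.Unary.All as All
open import Data.List.Membership.Propositional.Properties using (∈-upTo⁺)
open import Data.List.Extrema ≤-totalOrder using (max; xs≤max)

record Computable (n : ℕ) : Set where
  constructor computable
  field
    code     : Code n
    function : Vec ℕ n → ℕ
    computes : ∀ xs → code ▷ xs ⇓ function xs
open Computable

withFunction : ∀ {n} (t : Computable n) (f : Vec ℕ n → ℕ) → function t ≗ f → Computable n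
withFunction t f t≗f = computable (code t) f (λ xs → subst (code t ▷ xs ⇓_) (t≗f xs) (computes t xs))

unaryᶜ : (t : Computable 1) (f : ℕ → ℕ) → (∀ a → function t (a ∷ []) ≡ f a) → Computable 1
unaryᶜ t f t≗f = withFunction t (λ { (a ∷ []) → f a }) (λ { (a ∷ []) → t≗f a })

binaryᶜ : (t : Computable 2) (f : ℕ → ℕ → ℕ) → (∀ a b → function t (a ∷ b ∷ []) ≡ f a b) → Computable 2
binaryᶜ t f t≗f = withFunction t (λ { (a ∷ b ∷ []) → f a b }) (λ { (a ∷ b ∷ []) → t≗f a b })

ternaryᶜ : (t : Computable 3) (f : ℕ → ℕ → ℕ → ℕ) →
           (∀ a b c → function t (a ∷ b ∷ c ∷ []) ≡ f a b c) → Computable 3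
ternaryᶜ t f t≗f = withFunction t (λ { (a ∷ b ∷ c ∷ []) → f a b c }) (λ { (a ∷ b ∷ c ∷ []) → t≗f a b c })

zeroᶜ : ∀ {n} → Computable n
zeroᶜ = computable zer (λ _ → 0) (λ _ → ev-zer)

sucᶜ : Computable 1
sucᶜ = computable succ (λ { (x ∷ []) → suc x }) (λ { (x ∷ []) → ev-succ })

projᶜ : ∀ {n} → Fin n → Computable n
projᶜ i = computable (proj i) (λ xs → lookup xs i) (λ _ → ev-proj)

codes : ∀ {m n} → Vec (Computable n) m → Vec (Code n) m
codes []       = []
codes (t ∷ ts) = code t ∷ codes ts

functions : ∀ {m n} → Vec (Computable n) m → Vec ℕ n → Vec ℕ m
functions []       xs = []
functions (t ∷ ts) xs = function t xs ∷ functions ts xs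

computes* : ∀ {m n} (ts : Vec (Computable n) m) xs → codes ts ▷* xs ⇓* functions ts xs
computes* []       xs = ev-[]
computes* (t ∷ ts) xs = ev-∷ (computes t xs) (computes* ts xs)

compᶜ : ∀ {m n} → Computable m → Vec (Computable n) m → Computable n
compᶜ f gs = computable (comp (code f) (codes gs)) (λ xs → function f (functions gs xs))
                        (λ xs → ev-comp (computes* gs xs) (computes f _))

compᶜ₁ : ∀ {n} → Computable 1 → Computable n → Computable n
compᶜ₁ f a = compᶜ f (a ∷ [])

compᶜ₂ : ∀ {n} → Computable 2 → Computable n → Computable n → Computable n
compᶜ₂ f a b = compᶜ f (a ∷ b ∷ [])

compᶜ₃ : ∀ {n} → Computable 3 → Computable n → Computable n → Computable n → Computable n
compᶜ₃ f a b c = compᶜ f (a ∷ b ∷ c ∷ [])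

primRec : ∀ {n} → Computable n → Computable (suc (suc n)) → Vec ℕ n → ℕ → ℕ
primRec f g xs zero    = function f xs
primRec f g xs (suc k) = function g (k ∷ primRec f g xs k ∷ xs)

prec-computes : ∀ {n} (f : Computable n) (g : Computable (suc (suc n))) xs k →
                prec (code f) (code g) ▷ (k ∷ xs) ⇓ primRec f g xs k
prec-computes f g xs zero    = ev-prec0 (computes f xs)
prec-computes f g xs (suc k) = ev-precS (prec-computes f g xs k) (computes g _)

precᶜ : ∀ {n} → Computable n → Computable (suc (suc n)) → Computable (suc n)
precᶜ f g = computable (prec (code f) (code g)) (λ { (k ∷ xs) → primRec f g xs k })
                       (λ { (k ∷ xs) → prec-computes f g xs k })

constCode : ∀ {n} → ℕ → Code n
constCode zero    = zer
constCode (suc N) = comp succ (constCode N ∷ [])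

constCode-computes : ∀ {n} N {xs : Vec ℕ n} → constCode N ▷ xs ⇓ N
constCode-computes zero    = ev-zer
constCode-computes (suc N) = ev-comp (ev-∷ (constCode-computes N) ev-[]) ev-succ

constᶜ : ∀ {n} → ℕ → Computable n
constᶜ N = computable (constCode N) (λ _ → N) (λ _ → constCode-computes N)

renamingᶜ : ∀ {m} n → (Fin n → Fin m) → Vec (Computable m) n
renamingᶜ zero    ρ = []
renamingᶜ (suc n) ρ = projᶜ (ρ fz) ∷ renamingᶜ n (ρ ∘ fs)

functions-renamingᶜ : ∀ {m n} (ρ : Fin n → Fin m) ys (xs : Vec ℕ n) →
                      (∀ i → lookup ys (ρ i) ≡ lookup xs i) → functions (renamingᶜ n ρ) ys ≡ xs
functions-renamingᶜ ρ ys []       _ = refl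
functions-renamingᶜ ρ ys (x ∷ xs) h = cong₂ _∷_ (h fz) (functions-renamingᶜ (ρ ∘ fs) ys xs (h ∘ fs))

addᶜ : Computable 2
addᶜ = binaryᶜ t _+_ correct
  where
  t : Computable 2
  t = precᶜ (projᶜ fz) (compᶜ₁ sucᶜ (projᶜ (fs fz)))
  correct : ∀ a b → function t (a ∷ b ∷ []) ≡ a + b
  correct zero    b = refl
  correct (suc a) b = cong suc (correct a b)

mulᶜ : Computable 2
mulᶜ = binaryᶜ t _*_ correct
  where
  t : Computable 2
  t = precᶜ zeroᶜ (compᶜ₂ addᶜ (projᶜ (fs (fs fz))) (projᶜ (fs fz)))
  correct : ∀ a b → function t (a ∷ b ∷ []) ≡ a * b
  correct zero    b = refl
  correct (suc a) b = cong (b +_) (correct a b)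

predᶜ : Computable 1
predᶜ = unaryᶜ (precᶜ zeroᶜ (projᶜ fz)) pred λ { zero → refl ; (suc a) → refl }

monusᶜ : Computable 2
monusᶜ = binaryᶜ (compᶜ₂ t (projᶜ (fs fz)) (projᶜ fz)) _∸_ (λ a b → correct b a)
  where
  t : Computable 2
  t = precᶜ (projᶜ fz) (compᶜ₁ predᶜ (projᶜ (fs fz)))
  correct : ∀ b a → function t (b ∷ a ∷ []) ≡ a ∸ b
  correct zero    a = refl
  correct (suc b) a = trans (cong pred (correct b a)) (pred[m∸n]≡m∸[1+n] a b)

sg : ℕ → ℕ
sg zero    = 0
sg (suc _) = 1

nsg : ℕ → ℕ
nsg zero    = 1
nsg (suc _) = 0

sgᶜ : Computable 1
sgᶜ = unaryᶜ (precᶜ zeroᶜ (constᶜ 1)) sg λ { zero → refl ; (suc a) → refl }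

nsgᶜ : Computable 1
nsgᶜ = unaryᶜ (precᶜ (constᶜ 1) zeroᶜ) nsg λ { zero → refl ; (suc a) → refl }

isEqual : ℕ → ℕ → ℕ
isEqual a b = nsg ((a ∸ b) + (b ∸ a))

isEqualᶜ : Computable 2
isEqualᶜ = binaryᶜ (compᶜ₁ nsgᶜ (compᶜ₂ addᶜ (compᶜ₂ monusᶜ (projᶜ fz) (projᶜ (fs fz)))
                                              (compᶜ₂ monusᶜ (projᶜ (fs fz)) (projᶜ fz))))
                   isEqual (λ a b → refl)

isEqual-refl : ∀ a → isEqual a a ≡ 1
isEqual-refl a rewrite n∸n≡0 a = refl

isEqual-0∨1 : ∀ a b → isEqual a b ≡ 0 ⊎ isEqual a b ≡ 1
isEqual-0∨1 a b with (a ∸ b) + (b ∸ a)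
... | zero  = inj₂ refl
... | suc _ = inj₁ refl

isEqual≡1⇒≡ : ∀ a b → isEqual a b ≡ 1 → a ≡ b
isEqual≡1⇒≡ a b e with (a ∸ b) + (b ∸ a) in a-b+b-a≡0
... | zero = ≤-antisym (m∸n≡0⇒m≤n (m+n≡0⇒m≡0 (a ∸ b) a-b+b-a≡0))
                       (m∸n≡0⇒m≤n (m+n≡0⇒n≡0 (a ∸ b) a-b+b-a≡0))
isEqual≡1⇒≡ a b () | suc _

triᶜ : Computable 1
triᶜ = unaryᶜ t tri correct
  where
  t : Computable 1
  t = precᶜ zeroᶜ (compᶜ₂ addᶜ (compᶜ₁ sucᶜ (projᶜ fz)) (projᶜ (fs fz)))
  correct : ∀ a → function t (a ∷ []) ≡ tri a
  correct zero    = refl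
  correct (suc a) = cong (suc a +_) (correct a)

pairᶜ : Computable 2
pairᶜ = binaryᶜ (compᶜ₂ addᶜ (compᶜ₁ triᶜ (compᶜ₂ addᶜ (projᶜ fz) (projᶜ (fs fz)))) (projᶜ (fs fz)))
                pair (λ a b → refl)

mutual
  ⇓-deterministic : ∀ {n} {c : Code n} {xs y z} → c ▷ xs ⇓ y → c ▷ xs ⇓ z → y ≡ z
  ⇓-deterministic ev-zer ev-zer = refl
  ⇓-deterministic ev-succ ev-succ = refl
  ⇓-deterministic ev-proj ev-proj = refl
  ⇓-deterministic (ev-comp p q) (ev-comp p′ q′) with ⇓*-deterministic p p′
  ... | refl = ⇓-deterministic q q′
  ⇓-deterministic (ev-prec0 p) (ev-prec0 p′) = ⇓-deterministic p p′
  ⇓-deterministic (ev-precS p q) (ev-precS p′ q′) with ⇓-deterministic p p′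
  ... | refl = ⇓-deterministic q q′
  ⇓-deterministic (ev-mu {k = k} p below) (ev-mu {k = k′} p′ below′) with <-cmp k k′
  ... | tri< k<k′ _ _ = ⊥-elim (0≢1+n (⇓-deterministic p (proj₂ (below′ k k<k′))))
  ... | tri≈ _ k≡k′ _ = k≡k′
  ... | tri> _ _ k′<k = ⊥-elim (0≢1+n (⇓-deterministic p′ (proj₂ (below k′ k′<k))))

  ⇓*-deterministic : ∀ {m n} {gs : Vec (Code n) m} {xs ys zs} →
                     gs ▷* xs ⇓* ys → gs ▷* xs ⇓* zs → ys ≡ zs
  ⇓*-deterministic ev-[] ev-[] = refl
  ⇓*-deterministic (ev-∷ p ps) (ev-∷ q qs) = cong₂ _∷_ (⇓-deterministic p q) (⇓*-deterministic ps qs)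

allPositive : ∀ {m} → Vec ℕ m → ℕ
allPositive []       = 1
allPositive (r ∷ rs) = sg r * allPositive rs

-- The state of a μ-search: 0 while searching, 1 once some value was not available
-- within the budget t, and 2 + i once the first zero was found at i.
searchStep : ℕ → ℕ → ℕ → ℕ
searchStep (suc s) i r             = suc s
searchStep zero    i zero          = 1
searchStep zero    i (suc zero)    = suc (suc i)
searchStep zero    i (suc (suc _)) = 0

-- clocked c (t ∷ xs) evaluates c on xs with every μ-search cut off after t candidates:
-- it is 0 if the evaluation does not finish that way, and suc y if it yields y.
mutual
  clocked : ∀ {n} → Code n → Vec ℕ (suc n) → ℕ
  clocked zer         _               = 1
  clocked succ        (t ∷ x ∷ [])    = suc (suc x)
  clocked (proj i)    (t ∷ xs)        = suc (lookup xs i)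
  clocked (comp h gs) (t ∷ xs)        =
    allPositive (clocked* gs (t ∷ xs)) * clocked h (t ∷ map pred (clocked* gs (t ∷ xs)))
  clocked (prec a b)  (t ∷ k ∷ xs)    = clockedPrec a b t xs k
  clocked (mu h)      (t ∷ xs)        = clockedSearch h t xs t ∸ 1

  clocked* : ∀ {m n} → Vec (Code n) m → Vec ℕ (suc n) → Vec ℕ m
  clocked* []       _ = []
  clocked* (g ∷ gs) v = clocked g v ∷ clocked* gs v

  clockedPrec : ∀ {n} → Code n → Code (suc (suc n)) → ℕ → Vec ℕ n → ℕ → ℕ
  clockedPrec a b t xs zero    = clocked a (t ∷ xs)
  clockedPrec a b t xs (suc k) =
    sg (clockedPrec a b t xs k) * clocked b (t ∷ k ∷ pred (clockedPrec a b t xs k) ∷ xs)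

  clockedSearch : ∀ {n} → Code (suc n) → ℕ → Vec ℕ n → ℕ → ℕ
  clockedSearch h t xs zero    = 0
  clockedSearch h t xs (suc i) = searchStep (clockedSearch h t xs i) i (clocked h (t ∷ i ∷ xs))

searchStepᶜ : Computable 3
searchStepᶜ = ternaryᶜ t searchStep correct
  where
  t : Computable 3
  t = compᶜ₂ addᶜ (projᶜ fz)
        (compᶜ₂ mulᶜ (compᶜ₁ nsgᶜ (projᶜ fz))
          (compᶜ₂ addᶜ (compᶜ₁ nsgᶜ (projᶜ (fs (fs fz))))
            (compᶜ₂ mulᶜ (compᶜ₂ isEqualᶜ (projᶜ (fs (fs fz))) (constᶜ 1))
                         (compᶜ₁ sucᶜ (compᶜ₁ sucᶜ (projᶜ (fs fz)))))))
  correct : ∀ s i r → function t (s ∷ i ∷ r ∷ []) ≡ searchStep s i r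
  correct (suc s) i r             = cong suc (+-identityʳ s)
  correct zero    i zero          = refl
  correct zero    i (suc zero)    = trans (*-identityˡ _) (*-identityˡ _)
  correct zero    i (suc (suc r)) = refl

mutual
  clockedᶜ : ∀ {n} → Code n → Computable (suc n)
  clockedᶜ c = withFunction (clockedRawᶜ c) (clocked c) (clockedRawᶜ-correct c)

  allPositiveᶜ : ∀ {m n} → Vec (Code n) m → Computable (suc n)
  allPositiveᶜ []       = constᶜ 1
  allPositiveᶜ (g ∷ gs) = compᶜ₂ mulᶜ (compᶜ₁ sgᶜ (clockedᶜ g)) (allPositiveᶜ gs)

  predsᶜ : ∀ {m n} → Vec (Code n) m → Vec (Computable (suc n)) m
  predsᶜ []       = []
  predsᶜ (g ∷ gs) = compᶜ₁ predᶜ (clockedᶜ g) ∷ predsᶜ gs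

  -- arguments (k ∷ r ∷ t ∷ xs), with r the value at k
  precStepᶜ : ∀ {n} → Code (suc (suc n)) → Computable (suc (suc (suc n)))
  precStepᶜ {n} b = compᶜ₂ mulᶜ (compᶜ₁ sgᶜ (projᶜ (fs fz)))
    (compᶜ (clockedᶜ b) (projᶜ (fs (fs fz)) ∷ projᶜ fz ∷ compᶜ₁ predᶜ (projᶜ (fs fz)) ∷ renamingᶜ n (fs ∘ fs ∘ fs)))

  -- arguments (i ∷ s ∷ t ∷ xs), with s the search state before i
  searchStepAtᶜ : ∀ {n} → Code (suc n) → Computable (suc (suc (suc n)))
  searchStepAtᶜ {n} h = compᶜ₃ searchStepᶜ (projᶜ (fs fz)) (projᶜ fz)
    (compᶜ (clockedᶜ h) (projᶜ (fs (fs fz)) ∷ projᶜ fz ∷ renamingᶜ n (fs ∘ fs ∘ fs)))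

  clockedRawᶜ : ∀ {n} → Code n → Computable (suc n)
  clockedRawᶜ zer      = constᶜ 1
  clockedRawᶜ succ     = compᶜ₁ sucᶜ (compᶜ₁ sucᶜ (projᶜ (fs fz)))
  clockedRawᶜ (proj i) = compᶜ₁ sucᶜ (projᶜ (fs i))
  clockedRawᶜ (comp h gs) = compᶜ₂ mulᶜ (allPositiveᶜ gs) (compᶜ (clockedᶜ h) (projᶜ fz ∷ predsᶜ gs))
  clockedRawᶜ {suc n} (prec a b) =
    compᶜ (precᶜ (clockedᶜ a) (precStepᶜ b)) (projᶜ (fs fz) ∷ projᶜ fz ∷ renamingᶜ n (fs ∘ fs))
  clockedRawᶜ {n} (mu h) =
    compᶜ₂ monusᶜ (compᶜ (precᶜ zeroᶜ (searchStepAtᶜ h)) (projᶜ fz ∷ projᶜ fz ∷ renamingᶜ n fs)) (constᶜ 1)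

  allPositiveᶜ-correct : ∀ {m n} (gs : Vec (Code n) m) v →
                         function (allPositiveᶜ gs) v ≡ allPositive (clocked* gs v)
  allPositiveᶜ-correct []       v = refl
  allPositiveᶜ-correct (g ∷ gs) v = cong (sg (clocked g v) *_) (allPositiveᶜ-correct gs v)

  predsᶜ-correct : ∀ {m n} (gs : Vec (Code n) m) v → functions (predsᶜ gs) v ≡ map pred (clocked* gs v)
  predsᶜ-correct []       v = refl
  predsᶜ-correct (g ∷ gs) v = cong (pred (clocked g v) ∷_) (predsᶜ-correct gs v)

  precᶜ-correct : ∀ {n} (a : Code n) (b : Code (suc (suc n))) t xs k →
                  primRec (clockedᶜ a) (precStepᶜ b) (t ∷ xs) k ≡ clockedPrec a b t xs k
  precᶜ-correct a b t xs zero = refl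
  precᶜ-correct a b t xs (suc k)
    rewrite functions-renamingᶜ (fs ∘ fs ∘ fs) (k ∷ primRec (clockedᶜ a) (precStepᶜ b) (t ∷ xs) k ∷ t ∷ xs)
                                xs (λ _ → refl)
          | precᶜ-correct a b t xs k = refl

  searchᶜ-correct : ∀ {n} (h : Code (suc n)) t xs i →
                    primRec zeroᶜ (searchStepAtᶜ h) (t ∷ xs) i ≡ clockedSearch h t xs i
  searchᶜ-correct h t xs zero = refl
  searchᶜ-correct h t xs (suc i)
    rewrite functions-renamingᶜ (fs ∘ fs ∘ fs) (i ∷ primRec zeroᶜ (searchStepAtᶜ h) (t ∷ xs) i ∷ t ∷ xs)
                                xs (λ _ → refl)
          | searchᶜ-correct h t xs i = refl

  clockedRawᶜ-correct : ∀ {n} (c : Code n) → function (clockedRawᶜ c) ≗ clocked c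
  clockedRawᶜ-correct zer v = refl
  clockedRawᶜ-correct succ (t ∷ x ∷ []) = refl
  clockedRawᶜ-correct (proj i) (t ∷ xs) = refl
  clockedRawᶜ-correct (comp h gs) (t ∷ xs) =
    cong₂ _*_ (allPositiveᶜ-correct gs (t ∷ xs)) (cong (λ ys → clocked h (t ∷ ys)) (predsᶜ-correct gs (t ∷ xs)))
  clockedRawᶜ-correct (prec a b) (t ∷ k ∷ xs)
    rewrite functions-renamingᶜ (fs ∘ fs) (t ∷ k ∷ xs) xs (λ _ → refl) = precᶜ-correct a b t xs k
  clockedRawᶜ-correct (mu h) (t ∷ xs)
    rewrite functions-renamingᶜ fs (t ∷ xs) xs (λ _ → refl) = cong (_∸ 1) (searchᶜ-correct h t xs t)

allPositive-0∨1 : ∀ {m} (rs : Vec ℕ m) → allPositive rs ≡ 0 ⊎ allPositive rs ≡ 1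
allPositive-0∨1 []           = inj₂ refl
allPositive-0∨1 (zero  ∷ rs) = inj₁ refl
allPositive-0∨1 (suc r ∷ rs) = Data.Sum.map (trans (+-identityʳ _)) (trans (+-identityʳ _)) (allPositive-0∨1 rs)

1*m≡n⇒m≡n : ∀ {m n} → 1 * m ≡ n → m ≡ n
1*m≡n⇒m≡n {m} e = trans (sym (*-identityˡ m)) e

module _ {n} (h : Code (suc n)) (t : ℕ) (xs : Vec ℕ n) where
  private
    value : ℕ → ℕ
    value i = clocked h (t ∷ i ∷ xs)

  clockedSearch≡0⇒positive : ∀ s → clockedSearch h t xs s ≡ 0 → ∀ i → i < s → ∃[ v ] value i ≡ suc (suc v)
  clockedSearch≡0⇒positive (suc s) e i i<s with clockedSearch h t xs s in e₁ | value s in e₂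
  clockedSearch≡0⇒positive (suc s) () i i<s | suc _ | _
  clockedSearch≡0⇒positive (suc s) () i i<s | zero  | zero
  clockedSearch≡0⇒positive (suc s) () i i<s | zero  | suc zero
  clockedSearch≡0⇒positive (suc s) e  i i<s | zero  | suc (suc v) with m<1+n⇒m<n∨m≡n i<s
  ... | inj₁ i<s′  = clockedSearch≡0⇒positive s e₁ i i<s′
  ... | inj₂ refl = v , e₂

  clockedSearch≡2+⇒first-zero : ∀ s i → clockedSearch h t xs s ≡ suc (suc i) →
                                value i ≡ 1 × (∀ j → j < i → ∃[ v ] value j ≡ suc (suc v))
  clockedSearch≡2+⇒first-zero (suc s) i e with clockedSearch h t xs s in e₁ | value s in e₂
  ... | suc _ | _ = clockedSearch≡2+⇒first-zero s i (trans e₁ e)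
  clockedSearch≡2+⇒first-zero (suc s) i ()   | zero | zero
  clockedSearch≡2+⇒first-zero (suc s) i refl | zero | suc zero = e₂ , clockedSearch≡0⇒positive s e₁
  clockedSearch≡2+⇒first-zero (suc s) i ()   | zero | suc (suc _)

  module _ (k : ℕ) (value-k : value k ≡ 1) (below : ∀ i → i < k → ∃[ v ] value i ≡ suc (suc v)) where
    clockedSearch-before : ∀ s → s ≤ k → clockedSearch h t xs s ≡ 0
    clockedSearch-before zero    _   = refl
    clockedSearch-before (suc s) s<k with below s s<k
    ... | v , e rewrite clockedSearch-before s (<⇒≤ s<k) | e = refl

    clockedSearch-after : ∀ s → k < s → clockedSearch h t xs s ≡ suc (suc k)
    clockedSearch-after (suc s) k<1+s with m<1+n⇒m<n∨m≡n k<1+s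
    ... | inj₁ k<s  rewrite clockedSearch-after s k<s = refl
    ... | inj₂ refl rewrite clockedSearch-before s ≤-refl | value-k = refl

mutual
  clocked-sound : ∀ {n} (c : Code n) t xs y → clocked c (t ∷ xs) ≡ suc y → c ▷ xs ⇓ y
  clocked-sound zer      t xs y refl = ev-zer
  clocked-sound succ     t (x ∷ []) y refl = ev-succ
  clocked-sound (proj i) t xs y refl = ev-proj
  clocked-sound (comp h gs) t xs y e with allPositive-0∨1 (clocked* gs (t ∷ xs))
  ... | inj₁ e₀ rewrite e₀ = ⊥-elim (0≢1+n e)
  ... | inj₂ e₁ rewrite e₁ = ev-comp (clocked*-sound gs t xs e₁) (clocked-sound h t _ y (1*m≡n⇒m≡n e))
  clocked-sound (prec a b) t (k ∷ xs) y e = clockedPrec-sound a b t xs k y e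
  clocked-sound (mu h) t xs y e with clockedSearch h t xs t in found
  clocked-sound (mu h) t xs y () | zero
  clocked-sound (mu h) t xs y () | suc zero
  clocked-sound (mu h) t xs y refl | suc (suc i) with clockedSearch≡2+⇒first-zero h t xs t i found
  ... | value-i , below =
    ev-mu (clocked-sound h t _ 0 value-i)
          (λ j j<i → let (v , e) = below j j<i in v , clocked-sound h t _ (suc v) e)

  clocked*-sound : ∀ {m n} (gs : Vec (Code n) m) t xs → allPositive (clocked* gs (t ∷ xs)) ≡ 1 →
                   gs ▷* xs ⇓* map pred (clocked* gs (t ∷ xs))
  clocked*-sound []       t xs e = ev-[]
  clocked*-sound (g ∷ gs) t xs e with clocked g (t ∷ xs) in eg
  ... | zero  = ⊥-elim (0≢1+n e)
  ... | suc r = ev-∷ (clocked-sound g t xs r eg) (clocked*-sound gs t xs (1*m≡n⇒m≡n e))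

  clockedPrec-sound : ∀ {n} (a : Code n) (b : Code (suc (suc n))) t xs k y →
                      clockedPrec a b t xs k ≡ suc y → prec a b ▷ (k ∷ xs) ⇓ y
  clockedPrec-sound a b t xs zero    y e = ev-prec0 (clocked-sound a t xs y e)
  clockedPrec-sound a b t xs (suc k) y e with clockedPrec a b t xs k in ek
  ... | zero  = ⊥-elim (0≢1+n e)
  ... | suc r = ev-precS (clockedPrec-sound a b t xs k r ek) (clocked-sound b t _ y (1*m≡n⇒m≡n e))

Eventually : (ℕ → Set) → Set
Eventually P = ∃[ T ] (∀ t → T ≤ t → P t)

eventually-× : ∀ {P Q : ℕ → Set} → Eventually P → Eventually Q → Eventually (λ t → P t × Q t)
eventually-× (T₁ , p) (T₂ , q) =
  T₁ ⊔ T₂ , λ t le → p t (≤-trans (m≤m⊔n T₁ T₂) le) , q t (≤-trans (m≤n⊔m T₁ T₂) le)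

eventually-∀< : ∀ k (Q : ℕ → ℕ → Set) → (∀ i → i < k → Eventually (Q i)) →
                Eventually (λ t → ∀ i → i < k → Q i t)
eventually-∀< zero    Q h = 0 , λ _ _ _ ()
eventually-∀< (suc k) Q h
  with eventually-× (eventually-∀< k Q (λ i i<k → h i (m<n⇒m<1+n i<k))) (h k (n<1+n k))
... | T , r = T , λ t le i i<1+k → [ proj₁ (r t le) i , (λ { refl → proj₂ (r t le) }) ]′ (m<1+n⇒m<n∨m≡n i<1+k)

map-pred-suc : ∀ {m} (ys : Vec ℕ m) → map pred (map suc ys) ≡ ys
map-pred-suc ys = trans (sym (map-∘ pred suc ys)) (map-id ys)

allPositive-suc : ∀ {m} (ys : Vec ℕ m) → allPositive (map suc ys) ≡ 1
allPositive-suc []       = refl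
allPositive-suc (y ∷ ys) = trans (+-identityʳ _) (allPositive-suc ys)

clocked-comp : ∀ {m n} (h : Code m) (gs : Vec (Code n) m) {t xs} ys {y} →
               clocked* gs (t ∷ xs) ≡ map suc ys → clocked h (t ∷ ys) ≡ suc y →
               clocked (comp h gs) (t ∷ xs) ≡ suc y
clocked-comp h gs ys {y} e₁ e₂ rewrite e₁ | map-pred-suc ys | allPositive-suc ys | e₂ = cong suc (+-identityʳ y)

clockedPrec-suc : ∀ {n} (a : Code n) (b : Code (suc (suc n))) {t xs k r y} →
                  clockedPrec a b t xs k ≡ suc r → clocked b (t ∷ k ∷ r ∷ xs) ≡ suc y →
                  clockedPrec a b t xs (suc k) ≡ suc y
clockedPrec-suc a b {y = y} e₁ e₂ rewrite e₁ | e₂ = cong suc (+-identityʳ y)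

mutual
  clocked-complete : ∀ {n} {c : Code n} {xs y} → c ▷ xs ⇓ y → Eventually (λ t → clocked c (t ∷ xs) ≡ suc y)
  clocked-complete ev-zer  = 0 , λ _ _ → refl
  clocked-complete ev-succ = 0 , λ _ _ → refl
  clocked-complete ev-proj = 0 , λ _ _ → refl
  clocked-complete (ev-comp {f = h} {gs = gs} {ys = ys} p q)
    with eventually-× (clocked*-complete p) (clocked-complete q)
  ... | T , r = T , λ t le → clocked-comp h gs ys (proj₁ (r t le)) (proj₂ (r t le))
  clocked-complete (ev-prec0 p) = clocked-complete p
  clocked-complete (ev-precS {f = a} {g = b} p q) with eventually-× (clocked-complete p) (clocked-complete q)
  ... | T , r = T , λ t le → clockedPrec-suc a b (proj₁ (r t le)) (proj₂ (r t le))
  clocked-complete (ev-mu {f = h} {xs = xs} {k = k} p below)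
    with eventually-× (clocked-complete p)
                      (eventually-∀< k (λ i t → ∃[ v ] clocked h (t ∷ i ∷ xs) ≡ suc (suc v))
                        (λ i i<k → let (v , q) = below i i<k ; (T , r) = clocked-complete q
                                   in T , λ t le → v , r t le))
  ... | T , r = suc k ⊔ T , λ t le →
    let (value-k , positive) = r t (≤-trans (m≤n⊔m (suc k) T) le)
    in cong (_∸ 1) (clockedSearch-after h t xs k value-k positive t (≤-trans (m≤m⊔n (suc k) T) le))

  clocked*-complete : ∀ {m n} {gs : Vec (Code n) m} {xs ys} → gs ▷* xs ⇓* ys →
                      Eventually (λ t → clocked* gs (t ∷ xs) ≡ map suc ys)
  clocked*-complete ev-[] = 0 , λ _ _ → refl
  clocked*-complete (ev-∷ p ps) with eventually-× (clocked-complete p) (clocked*-complete ps)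
  ... | T , r = T , λ t le → cong₂ _∷_ (proj₁ (r t le)) (proj₂ (r t le))

-- Gödel numbers are computed with an opaque copy of pair, so that the quine equation
-- below holds by refl without normalising huge numerals.
opaque
  pairᵒ : ℕ → ℕ → ℕ
  pairᵒ = pair

  pairᵒ≡pair : ∀ a b → pairᵒ a b ≡ pair a b
  pairᵒ≡pair a b = refl

pair≡pairᵒ : ∀ {a a′ b b′} → a ≡ a′ → b ≡ b′ → pair a b ≡ pairᵒ a′ b′
pair≡pairᵒ refl refl = sym (pairᵒ≡pair _ _)

mutual
  ⌜_⌝ᵒ : ∀ {n} → Code n → ℕ
  ⌜ zer {n} ⌝ᵒ           = pairᵒ 0 n
  ⌜ succ ⌝ᵒ              = pairᵒ 1 0
  ⌜ proj {n} i ⌝ᵒ        = pairᵒ 2 (pairᵒ n (toℕ i))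
  ⌜ comp {m} {n} f gs ⌝ᵒ = pairᵒ 3 (pairᵒ m (pairᵒ n (pairᵒ ⌜ f ⌝ᵒ ⌜ gs ⌝*ᵒ)))
  ⌜ prec {n} f g ⌝ᵒ      = pairᵒ 4 (pairᵒ n (pairᵒ ⌜ f ⌝ᵒ ⌜ g ⌝ᵒ))
  ⌜ mu {n} f ⌝ᵒ          = pairᵒ 5 (pairᵒ n ⌜ f ⌝ᵒ)

  ⌜_⌝*ᵒ : ∀ {m n} → Vec (Code n) m → ℕ
  ⌜ [] ⌝*ᵒ     = 0
  ⌜ g ∷ gs ⌝*ᵒ = suc (pairᵒ ⌜ g ⌝ᵒ ⌜ gs ⌝*ᵒ)

mutual
  ⌜⌝≡⌜⌝ᵒ : ∀ {n} (c : Code n) → ⌜ c ⌝ ≡ ⌜ c ⌝ᵒ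
  ⌜⌝≡⌜⌝ᵒ zer         = pair≡pairᵒ refl refl
  ⌜⌝≡⌜⌝ᵒ succ        = pair≡pairᵒ refl refl
  ⌜⌝≡⌜⌝ᵒ (proj i)    = pair≡pairᵒ refl (pair≡pairᵒ refl refl)
  ⌜⌝≡⌜⌝ᵒ (comp f gs) = pair≡pairᵒ refl (pair≡pairᵒ refl (pair≡pairᵒ refl (pair≡pairᵒ (⌜⌝≡⌜⌝ᵒ f) (⌜⌝*≡⌜⌝*ᵒ gs))))
  ⌜⌝≡⌜⌝ᵒ (prec f g)  = pair≡pairᵒ refl (pair≡pairᵒ refl (pair≡pairᵒ (⌜⌝≡⌜⌝ᵒ f) (⌜⌝≡⌜⌝ᵒ g)))
  ⌜⌝≡⌜⌝ᵒ (mu f)      = pair≡pairᵒ refl (pair≡pairᵒ refl (⌜⌝≡⌜⌝ᵒ f))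

  ⌜⌝*≡⌜⌝*ᵒ : ∀ {m n} (gs : Vec (Code n) m) → ⌜ gs ⌝* ≡ ⌜ gs ⌝*ᵒ
  ⌜⌝*≡⌜⌝*ᵒ []       = refl
  ⌜⌝*≡⌜⌝*ᵒ (g ∷ gs) = cong suc (pair≡pairᵒ (⌜⌝≡⌜⌝ᵒ g) (⌜⌝*≡⌜⌝*ᵒ gs))

⌜_⌝Sᵒ : SysCode → ℕ
⌜ S ⌝Sᵒ = pairᵒ k (pairᵒ x0 (pairᵒ ⌜ le ⌝ᵒ (pairᵒ ⌜ tr ⌝ᵒ (pairᵒ ⌜ plen ⌝ᵒ ⌜ pelem ⌝ᵒ))))
  where open SysCode S

⌜⌝S≡⌜⌝Sᵒ : ∀ S → ⌜ S ⌝S ≡ ⌜ S ⌝Sᵒ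
⌜⌝S≡⌜⌝Sᵒ S = pair≡pairᵒ refl (pair≡pairᵒ refl (pair≡pairᵒ (⌜⌝≡⌜⌝ᵒ le)
               (pair≡pairᵒ (⌜⌝≡⌜⌝ᵒ tr) (pair≡pairᵒ (⌜⌝≡⌜⌝ᵒ plen) (⌜⌝≡⌜⌝ᵒ pelem)))))
  where open SysCode S

pairᵒᶜ : Computable 2
pairᵒᶜ = binaryᶜ pairᶜ pairᵒ (λ a b → sym (pairᵒ≡pair a b))

quoteCompᶜ : ∀ {n} (m l : ℕ) → Computable n → Computable n → Computable n
quoteCompᶜ m l f gs = compᶜ₂ pairᵒᶜ (constᶜ 3) (compᶜ₂ pairᵒᶜ (constᶜ m) (compᶜ₂ pairᵒᶜ (constᶜ l) (compᶜ₂ pairᵒᶜ f gs)))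

quoteConsᶜ : ∀ {n} → Computable n → Computable n → Computable n
quoteConsᶜ g gs = compᶜ₁ sucᶜ (compᶜ₂ pairᵒᶜ g gs)

quoteConstCodeᶜ : Computable 1
quoteConstCodeᶜ = unaryᶜ t (λ m → ⌜ constCode {1} m ⌝ᵒ) correct
  where
  t : Computable 1
  t = precᶜ (constᶜ ⌜ zer {1} ⌝ᵒ) (quoteCompᶜ 1 1 (constᶜ ⌜ succ ⌝ᵒ) (quoteConsᶜ (projᶜ (fs fz)) (constᶜ 0)))
  correct : ∀ m → function t (m ∷ []) ≡ ⌜ constCode {1} m ⌝ᵒ
  correct zero    = refl
  correct (suc m) = cong (λ q → pairᵒ 3 (pairᵒ 1 (pairᵒ 1 (pairᵒ ⌜ succ ⌝ᵒ (suc (pairᵒ q 0)))))) (correct m)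

advance : ℕ → ℕ
advance (suc zero) = 0
advance _          = 1

advance≤1 : ∀ r → advance r ≤ 1
advance≤1 zero          = ≤-refl
advance≤1 (suc zero)    = z≤n
advance≤1 (suc (suc r)) = ≤-refl

advance-≢1 : ∀ {r} → r ≢ 1 → advance r ≡ 1
advance-≢1 {zero}        _   = refl
advance-≢1 {suc zero}    r≢1 = ⊥-elim (r≢1 refl)
advance-≢1 {suc (suc r)} _   = refl

advanceᶜ : Computable 1
advanceᶜ = unaryᶜ (compᶜ₁ nsgᶜ (compᶜ₂ isEqualᶜ (projᶜ fz) (constᶜ 1))) advance
                  λ { zero → refl ; (suc zero) → refl ; (suc (suc r)) → refl }

DecidesBoundedness : Code 1 → SysCode → Set
DecidesBoundedness d S = (Bounded S → d ▷ (⌜ S ⌝S ∷ []) ⇓ 1) × (¬ Bounded S → d ▷ (⌜ S ⌝S ∷ []) ⇓ 0)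

module Diagonal (d : Code 1) where

  nextᶜ : Computable 2
  nextᶜ = compᶜ₂ addᶜ (projᶜ fz) (compᶜ₁ advanceᶜ (clockedᶜ d))

  nextCode : Code 1 → ℕ → Code 1
  nextCode self m = comp (code nextᶜ) (proj fz ∷ comp self (constCode m ∷ []) ∷ [])

  -- The counter x ↦ x + 1 on ℕ, under the total order, which stops once d, run with
  -- budget x on the output w of self on m, has answered 0.
  system : Code 1 → ℕ → SysCode
  system self m = record
    { k     = 1
    ; x0    = 0
    ; le    = constCode 1
    ; tr    = comp (code isEqualᶜ) (proj (fs (fs fz)) ∷ comp (nextCode self m) (proj (fs fz) ∷ []) ∷ [])
    ; plen  = constCode 1
    ; pelem = comp (nextCode self m) (proj fz ∷ [])
    }

  quoteNextCodeᶜ : Computable 2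
  quoteNextCodeᶜ = quoteCompᶜ 2 1 (constᶜ ⌜ code nextᶜ ⌝ᵒ)
    (quoteConsᶜ (constᶜ ⌜ proj {1} fz ⌝ᵒ)
      (quoteConsᶜ (quoteCompᶜ 1 1 (projᶜ fz) (quoteConsᶜ (compᶜ₁ quoteConstCodeᶜ (projᶜ (fs fz))) (constᶜ 0)))
        (constᶜ 0)))

  quoteSystemᶜ : Computable 2
  quoteSystemᶜ =
    compᶜ₂ pairᵒᶜ (constᶜ 1) (compᶜ₂ pairᵒᶜ (constᶜ 0) (compᶜ₂ pairᵒᶜ (constᶜ ⌜ constCode {2} 1 ⌝ᵒ)
      (compᶜ₂ pairᵒᶜ quoteTr (compᶜ₂ pairᵒᶜ (constᶜ ⌜ constCode {1} 1 ⌝ᵒ) quotePelem))))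
    where
    quoteTr : Computable 2
    quoteTr = quoteCompᶜ 2 3 (constᶜ ⌜ code isEqualᶜ ⌝ᵒ)
      (quoteConsᶜ (constᶜ ⌜ proj {3} (fs (fs fz)) ⌝ᵒ)
        (quoteConsᶜ (quoteCompᶜ 1 3 quoteNextCodeᶜ (quoteConsᶜ (constᶜ ⌜ proj {3} (fs fz) ⌝ᵒ) (constᶜ 0)))
          (constᶜ 0)))
    quotePelem : Computable 2
    quotePelem = quoteCompᶜ 1 2 quoteNextCodeᶜ (quoteConsᶜ (constᶜ ⌜ proj {2} fz ⌝ᵒ) (constᶜ 0))

  quoteSystemᶜ-correct : ∀ self m → function quoteSystemᶜ (⌜ self ⌝ᵒ ∷ m ∷ []) ≡ ⌜ system self m ⌝Sᵒ
  quoteSystemᶜ-correct self m = refl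

  selfQuoteᶜ : Computable 1
  selfQuoteᶜ = compᶜ₂ quoteSystemᶜ (projᶜ fz) (projᶜ fz)

  -- For self = code selfQuoteᶜ this is the fixed point: system self ⌜ self ⌝ feeds d its
  -- own Gödel number.
  selfQuoteᶜ-correct : ∀ self → function selfQuoteᶜ (⌜ self ⌝ ∷ []) ≡ ⌜ system self ⌜ self ⌝ ⌝S
  selfQuoteᶜ-correct self = begin
    function quoteSystemᶜ (⌜ self ⌝ ∷ ⌜ self ⌝ ∷ [])  ≡⟨ cong (λ q → function quoteSystemᶜ (q ∷ ⌜ self ⌝ ∷ [])) (⌜⌝≡⌜⌝ᵒ self) ⟩
    function quoteSystemᶜ (⌜ self ⌝ᵒ ∷ ⌜ self ⌝ ∷ []) ≡⟨ quoteSystemᶜ-correct self ⌜ self ⌝ ⟩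
    ⌜ system self ⌜ self ⌝ ⌝Sᵒ                      ≡⟨ sym (⌜⌝S≡⌜⌝Sᵒ (system self ⌜ self ⌝)) ⟩
    ⌜ system self ⌜ self ⌝ ⌝S                       ∎
    where open ≡-Reasoning

  -- system self m is written out below, never abbreviated: checking an abbreviation against
  -- it can unfold ⌜_⌝S, and Agda would then evaluate an astronomically large Gödel number.
  module Analysis (self : Code 1) (m w : ℕ) (self⇓w : self ▷ (m ∷ []) ⇓ w) where

    next : ℕ → ℕ
    next x = x + advance (clocked d (x ∷ w ∷ []))

    nextCode-computes : ∀ x → nextCode self m ▷ (x ∷ []) ⇓ next x
    nextCode-computes x =
      ev-comp (ev-∷ ev-proj (ev-∷ (ev-comp (ev-∷ (constCode-computes m) ev-[]) self⇓w) ev-[]))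
              (computes nextᶜ (x ∷ w ∷ []))

    tr-computes : ∀ a x y → SysCode.tr (system self m) ▷ (a ∷ x ∷ y ∷ []) ⇓ isEqual y (next x)
    tr-computes a x y = ev-comp (ev-∷ ev-proj (ev-∷ (ev-comp (ev-∷ ev-proj ev-[]) (nextCode-computes x)) ev-[]))
                                (computes isEqualᶜ (y ∷ next x ∷ []))

    pelem-computes : ∀ x i → SysCode.pelem (system self m) ▷ (x ∷ i ∷ []) ⇓ next x
    pelem-computes x i = ev-comp (ev-∷ ev-proj ev-[]) (nextCode-computes x)

    ≼-total : ∀ x y → _≼_ (system self m) x y
    ≼-total _ _ = constCode-computes 1

    step⇒≡next : ∀ {x a y} → Step (system self m) x a y → y ≡ next x
    step⇒≡next {x} {a} {y} step = isEqual≡1⇒≡ y (next x) (⇓-deterministic (tr-computes (toℕ a) x y) step)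

    step-next : ∀ x a → Step (system self m) x a (next x)
    step-next x a = subst (SysCode.tr (system self m) ▷ (toℕ a ∷ x ∷ next x ∷ []) ⇓_) (isEqual-refl (next x))
                          (tr-computes (toℕ a) x (next x))

    run : ∀ x σ → ∃[ y ] StepW (system self m) x σ y
    run x List.[]      = x , ε
    run x (a List.∷ σ) = let (y , steps) = run (next x) σ in y , (step-next x a ◅ steps)

    isEffectiveWqoBranchWSTS : IsEffectiveWqoBranchWSTS (system self m)
    isEffectiveWqoBranchWSTS = isWqo , isBranchWqo , isBranchMonotone , isBranchEffective
      where
      isWqo : IsWqo (system self m)
      isWqo = ((λ x → ≼-total x x) , λ x _ z _ _ → ≼-total x z) , λ _ → 0 , 1 , s≤s z≤n , ≼-total _ _

      isBranchWqo : IsBranchWqo (system self m)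
      isBranchWqo _ _ _ _ _ = 0 , 1 , s≤s z≤n , ≼-total _ _

      isBranchMonotone : IsBranchMonotone (system self m)
      isBranchMonotone _ x′ σ _ _ = let (y , steps) = run x′ σ in y , steps , ≼-total x′ y

      tr-0∨1 : ∀ a x y → SysCode.tr (system self m) ▷ (a ∷ x ∷ y ∷ []) ⇓ 0
                       ⊎ SysCode.tr (system self m) ▷ (a ∷ x ∷ y ∷ []) ⇓ 1
      tr-0∨1 a x y = Data.Sum.map (λ e → subst (_ ▷ _ ⇓_) e (tr-computes a x y))
                                  (λ e → subst (_ ▷ _ ⇓_) e (tr-computes a x y)) (isEqual-0∨1 y (next x))

      isBranchEffective : IsBranchEffective (system self m)
      isBranchEffective =
          (λ x y → inj₂ (≼-total x y))
        , (λ a → tr-0∨1 (toℕ a))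
        , (λ _ → 1 , constCode-computes 1)
        , (λ x i → next x , pelem-computes x i)
        , λ x y → mk⇔
            (λ (_ , step) → 1 , 0 , constCode-computes 1 , s≤s z≤n
                          , subst (_ ▷ _ ⇓_) (sym (step⇒≡next step)) (pelem-computes x 0))
            (λ (_ , i , _ , _ , pelem⇓y) →
               fz , subst (Step (system self m) x fz) (⇓-deterministic (pelem-computes x i) pelem⇓y) (step-next x fz))

    next-≤ : ∀ T → clocked d (T ∷ w ∷ []) ≡ 1 → ∀ {x} → x ≤ T → next x ≤ T
    next-≤ T answered {x} x≤T with m≤n⇒m<n∨m≡n x≤T
    ... | inj₁ x<T  = ≤-trans (+-monoʳ-≤ x (advance≤1 _)) (subst (_≤ T) (+-comm 1 x) x<T)
    ... | inj₂ refl = ≤-reflexive (trans (cong (λ r → x + advance r) answered) (+-identityʳ x))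

    bounded-once-answered : ∀ T → clocked d (T ∷ w ∷ []) ≡ 1 → Bounded (system self m)
    bounded-once-answered T answered = List.upTo (suc T) , λ y (σ , steps) → ∈-upTo⁺ (s≤s (reach-≤ steps z≤n))
      where
      reach-≤ : ∀ {x σ y} → StepW (system self m) x σ y → x ≤ T → y ≤ T
      reach-≤ ε              x≤T = x≤T
      reach-≤ (step ◅ steps) x≤T = reach-≤ steps (subst (_≤ T) (sym (step⇒≡next step)) (next-≤ T answered x≤T))

    unbounded-unless-answered : (∀ t → clocked d (t ∷ w ∷ []) ≢ 1) → ¬ Bounded (system self m)
    unbounded-unless-answered never (L , reachable∈L) =
      1+n≰n (All.lookup (xs≤max 0 L) (reachable∈L n (reach n 0)))
      where
      n : ℕ
      n = suc (max 0 L)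
      next≡suc : ∀ x → next x ≡ suc x
      next≡suc x = trans (cong (x +_) (advance-≢1 (never x))) (+-comm x 1)
      reach : ∀ j x → Reach (system self m) x (x + j)
      reach zero    x = List.[] , subst (StepW (system self m) x List.[]) (sym (+-identityʳ x)) ε
      reach (suc j) x =
        let (σ , steps) = reach j (suc x)
        in fz List.∷ σ , subst (Step (system self m) x fz) (next≡suc x) (step-next x fz)
                         ◅ subst (StepW (system self m) (suc x) σ) (sym (+-suc x j)) steps

    answered-0⇒bounded : d ▷ (w ∷ []) ⇓ 0 → Bounded (system self m)
    answered-0⇒bounded d⇓0 =
      let (T , answered) = clocked-complete d⇓0 in bounded-once-answered T (answered T ≤-refl)

    answered-1⇒unbounded : d ▷ (w ∷ []) ⇓ 1 → ¬ Bounded (system self m)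
    answered-1⇒unbounded d⇓1 = unbounded-unless-answered
      (λ t answered → 0≢1+n (⇓-deterministic (clocked-sound d t (w ∷ []) 0 answered) d⇓1))

    decider-fails : w ≡ ⌜ system self m ⌝S → ¬ DecidesBoundedness d (system self m)
    decider-fails w≡⌜S⌝ (says-bounded , says-unbounded) =
      unbounded (answered-0⇒bounded (d⇓ (says-unbounded unbounded)))
      where
      d⇓ : ∀ {b} → d ▷ (⌜ system self m ⌝S ∷ []) ⇓ b → d ▷ (w ∷ []) ⇓ b
      d⇓ {b} = subst (λ n → d ▷ (n ∷ []) ⇓ b) (sym w≡⌜S⌝)
      unbounded : ¬ Bounded (system self m)
      unbounded bounded = answered-1⇒unbounded (d⇓ (says-bounded bounded)) bounded

proposition3p16 : ¬ (Σ (Code 1) λ d →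
                      (S : SysCode) → IsEffectiveWqoBranchWSTS S →
                      (Bounded S → d ▷ (⌜ S ⌝S ∷ []) ⇓ 1) ×
                      (¬ Bounded S → d ▷ (⌜ S ⌝S ∷ []) ⇓ 0))
proposition3p16 (d , decider) =
  decider-fails (selfQuoteᶜ-correct self) (decider (system self ⌜ self ⌝) isEffectiveWqoBranchWSTS)
  where
  open Diagonal d
  self : Code 1
  self = code selfQuoteᶜ
  open Analysis self ⌜ self ⌝ (function selfQuoteᶜ (⌜ self ⌝ ∷ [])) (computes selfQuoteᶜ (⌜ self ⌝ ∷ []))
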